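{- Let $p$ be a prime, let $d\ge 0$ and $n\ge 1$ be integers, and let $A\subseteq\{0,1\}^n\subseteq\mathbb{F}_p^n$ satisfy $\lvert A\rvert> p\cdot\lvert\mathcal{M}_{\lfloor d/p\rfloor}(p,n)\rvert$. Then $\textsf{int-deg}_p(p\cdot A)>d$, where $p\cdot A=\{a_1+\dots+a_p\mid a_1,\dots,a_p\in A\}$ (sums in $\mathbb{F}_p^n$).
   Context: A polynomial in $\mathbb{F}_p[x_1,\dots,x_n]$ is $p$-reduced if each variable appears with individual degree at most $p-1$. $\mathcal{M}_k(p,n)$ denotes the set of monomials in $x_1,\dots,x_n$ in which each variable has degree at most $p-1$ and the total degree is at most $k$. For $B\subseteq\mathbb{F}_p^n$, $\textsf{int-deg}_p(B)$ is the minimum $d$ such that every function $f:B\to\mathbb{F}_p$ agrees on $B$ with some $p$-reduced polynomial of total degree at most $d$. -}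

module Defs where

open import Data.Nat using (ℕ; zero; suc; _+_; _*_; _^_; _≤_; _≤?_; NonZero)
open import Data.Nat.DivMod using (_mod_)
open import Data.Fin using (Fin; toℕ)
open import Data.Bool using (Bool; true; false)
open import Data.Vec using (Vec; []; _∷_; lookup; zipWith; replicate; foldr)
open import Data.List using (List; []; _∷_; concatMap; map; filter; length)
open import Data.Nat.ListAction using (sum)
open import Data.List.Membership.Propositional using (_∈_)
open import Data.Product using (Σ; _×_; ∃)
open import Relation.Binary.PropositionalEquality using (_≡_; _≢_)

module _ (p : ℕ) .{{_ : NonZero p}} where

  F : Set
  F = Fin p

  _+F_ : F → F → F
  a +F b = (toℕ a + toℕ b) mod p

  0F : F
  0F = 0 mod p

  1F : F
  1F = 1 mod p

  Pt : ℕ → Set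
  Pt n = Vec F n

  _+P_ : ∀ {n} → Pt n → Pt n → Pt n
  _+P_ = zipWith _+F_

  bit : Bool → F
  bit false = 0F
  bit true  = 1F

  embed : ∀ {n} → Vec Bool n → Pt n
  embed = Data.Vec.map bit

  sumP : ∀ {n k} → Vec (Pt n) k → Pt n
  sumP {n} = foldr (λ _ → Pt n) _+P_ (replicate n 0F)

  _∈pA_ : ∀ {n} → Pt n → List (Vec Bool n) → Set
  _∈pA_ {n} x A =
    Σ (Vec (Vec Bool n) p) λ as →
      (∀ (i : Fin p) → lookup as i ∈ A) × sumP (Data.Vec.map embed as) ≡ x

  -- p-reduced monomials: exponent vectors with each exponent in {0,…,p-1}
  Mono : ℕ → Set
  Mono n = Vec (Fin p) n

  totalDeg : ∀ {n} → Mono n → ℕ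
  totalDeg [] = 0
  totalDeg (e ∷ es) = toℕ e + totalDeg es

  allFin : List (Fin p)
  allFin = Data.List.allFin p

  allMonos : (n : ℕ) → List (Mono n)
  allMonos zero = [] ∷ []
  allMonos (suc n) = concatMap (λ e → map (e ∷_) (allMonos n)) allFin

  M : ℕ → (n : ℕ) → List (Mono n)
  M k n = filter (λ e → totalDeg e ≤? k) (allMonos n)

  card-M : ℕ → ℕ → ℕ
  card-M k n = length (M k n)

  Poly : ℕ → Set
  Poly n = Mono n → F

  HasDegLe : ∀ {n} → Poly n → ℕ → Set
  HasDegLe c d = ∀ e → c e ≢ 0F → totalDeg e ≤ d

  monoValℕ : ∀ {n} → Mono n → Pt n → ℕ
  monoValℕ [] [] = 1
  monoValℕ (e ∷ es) (x ∷ xs) = (toℕ x ^ toℕ e) * monoValℕ es xs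

  eval : ∀ {n} → Poly n → Pt n → F
  eval {n} c x = sum (map (λ e → toℕ (c e) * monoValℕ e x) (allMonos n)) mod p

  -- B is given as a predicate on F_p^n;
  -- functions B → F_p are represented by functions F_p^n → F_p (any function
  -- on B extends), agreement being required only on B.
  IntDegLe : ∀ {n} → (Pt n → Set) → ℕ → Set
  IntDegLe {n} B d =
    ∀ (f : Pt n → F) → Σ (Poly n) λ c → HasDegLe c d × (∀ x → B x → eval c x ≡ f x)

module Submission where

-- Proof by slice rank.  Suppose the indicator of the origin agrees on p·A with
-- a polynomial c of degree ≤ d, and let T(a₁,…,a_p) = c(a₁ + ⋯ + a_p) for aᵢ ∈ A.
-- Since p bits sum to 0 in F_p exactly when they are all equal, T is a diagonal
-- tensor with nonzero diagonal, so by the slice-rank bound |A| ≤ p·r whenever T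
-- decomposes with r functions per slot.  On {0,1}^n, c(a₁ + ⋯ + a_p) expands
-- into products of multilinear monomials of the p slots of total degree ≤ d;
-- by pigeonhole each product has a slot of degree ≤ ⌊d/p⌋, so r = |M_⌊d/p⌋(p,n)|.

open import Level using (0ℓ)
open import Algebra.Bundles using (CommutativeRing; CommutativeMonoid; Semiring)
open import Algebra.Structures using (IsCommutativeRing)
open import Algebra.Core using (Op₁; Op₂)
open import Data.Bool using (Bool; true; false; _∧_; _∨_; not; if_then_else_)
import Data.Bool.Properties as Bool
open import Data.Bool.Properties using (∧-identityʳ)
open import Data.Nat as ℕ using (ℕ; zero; suc; _≤_; z≤n; s≤s)
import Data.Nat.Properties as ℕ
open import Data.Nat.DivMod
  using (_mod_; _%_; _/_; m≡m%n+[m/n]*n; m%n<n; m<n⇒m%n≡m; m%n%n≡m%n; %-distribˡ-+; %-distribˡ-*; m*n%n≡0; n%n≡0)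
open import Data.Nat.Divisibility using (_∣_; m%n≡0⇒n∣m; n∣m⇒m%n≡0)
open import Data.Nat.Primality using (Prime; euclidsLemma; ¬prime[0]; ¬prime[1])
open import Data.Nat.ListAction using () renaming (sum to sumℕ)
open import Data.Fin as Fin using (Fin; zero; suc; toℕ; punchIn; _↑ˡ_; _↑ʳ_; splitAt)
import Data.Fin.Properties as Fin
open import Data.Fin.Subset using (Subset; ⊥; ⁅_⁆; _∪_; ∣_∣)
open import Data.Fin.Subset.Properties using (∣⊥∣≡0; ∣⊤∣≡n; ∣p∣≤n; ∣p∣≡n⇒p≡⊤; ∣⁅x⁆∣≡1)
open import Data.Vec as Vec using (Vec; []; _∷_; lookup; replicate; removeAt)
import Data.Vec.Properties as Vec
import Data.Vec.Functional as Vector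
import Data.Vec.Functional.Properties as Vector
open import Data.List as List using (List; []; _∷_; _++_)
open import Data.List.Membership.Propositional using (_∈_)
open import Data.List.Membership.Propositional.Properties using (∈-map⁺; ∈-concat⁺′; ∈-allFin; ∈-filter⁺; ∈-lookup)
open import Data.List.Relation.Unary.All as All using (All; []; _∷_)
import Data.List.Relation.Unary.All.Properties as All
open import Data.List.Relation.Unary.Any using (here)
import Data.List.Relation.Unary.Any as Any
import Data.List.Relation.Unary.Any.Properties as Any
open import Data.List.Relation.Unary.AllPairs using (_∷_)
open import Data.List.Relation.Unary.Unique.Propositional using (Unique)
open import Data.Sum using (inj₁; inj₂; [_,_]′)
open import Data.Product using (Σ; _×_; _,_; proj₁; proj₂)
open import Function using (_∘_; id)
open import Function.Definitions using (Injective)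
open import Relation.Binary.Definitions using (DecidableEquality)
open import Relation.Binary.PropositionalEquality hiding ([_])
open import Relation.Nullary using (¬_; yes; no; does)
open import Relation.Nullary.Decidable using (dec-true; dec-false)
open import Relation.Nullary.Negation using (contradiction)
open import Defs
  using (_+F_; 0F; 1F; bit; embed; Pt; sumP; _∈pA_; Mono; totalDeg; allMonos; M; card-M; Poly; HasDegLe;
         monoValℕ; eval; IntDegLe)

vec-ext : ∀ {A : Set} {k} {xs ys : Vec A k} → (∀ i → lookup xs i ≡ lookup ys i) → xs ≡ ys
vec-ext {xs = xs} {ys} eq = begin
  xs                    ≡⟨ Vec.tabulate∘lookup xs ⟨
  Vec.tabulate (lookup xs) ≡⟨ Vec.tabulate-cong eq ⟩
  Vec.tabulate (lookup ys) ≡⟨ Vec.tabulate∘lookup ys ⟩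
  ys                    ∎
  where open ≡-Reasoning

removeAt-suc : ∀ {A : Set} {k} (x : A) (xs : Vec A (suc k)) i → removeAt (x ∷ xs) (suc i) ≡ x ∷ removeAt xs i
removeAt-suc x (_ ∷ _) i = refl

removeAt-map : ∀ {A B : Set} {k} (f : A → B) (xs : Vec A (suc k)) i →
               removeAt (Vec.map f xs) i ≡ Vec.map f (removeAt xs i)
removeAt-map f (x ∷ xs)     zero    = refl
removeAt-map f (x ∷ y ∷ xs) (suc i) = cong (f x ∷_) (removeAt-map f (y ∷ xs) i)

lookup-injective : ∀ {A : Set} {xs : List A} → Unique xs → Injective _≡_ _≡_ (List.lookup xs)
lookup-injective {xs = x ∷ xs} (x∉xs ∷ u) {zero}  {zero}  _  = refl
lookup-injective {xs = x ∷ xs} (x∉xs ∷ u) {zero}  {suc j} eq = contradiction eq (All.lookup x∉xs (∈-lookup j))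
lookup-injective {xs = x ∷ xs} (x∉xs ∷ u) {suc i} {zero}  eq = contradiction (sym eq) (All.lookup x∉xs (∈-lookup i))
lookup-injective {xs = x ∷ xs} (x∉xs ∷ u) {suc i} {suc j} eq = cong suc (lookup-injective u eq)

empty-fin : ∀ {n} → ¬ Fin n → n ≡ 0
empty-fin {zero}  _     = refl
empty-fin {suc n} ¬fin = contradiction zero ¬fin

AllEqual : ∀ {A : Set} {k} → Vec A k → Set
AllEqual as = ∀ i j → lookup as i ≡ lookup as j

replicate-allEqual : ∀ {A : Set} {k} (a : A) → AllEqual (replicate k a)
replicate-allEqual a i j = trans (Vec.lookup-replicate i a) (sym (Vec.lookup-replicate j a))

record DecidableIntegralDomain : Set₁ where
  infixl 6 _+_
  infixl 7 _*_
  infix  8 -_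
  field
    Carrier           : Set
    _+_ _*_           : Op₂ Carrier
    -_                : Op₁ Carrier
    0# 1#             : Carrier
    isCommutativeRing : IsCommutativeRing _≡_ _+_ _*_ -_ 0# 1#
    _≟_               : DecidableEquality Carrier
    1≢0               : 1# ≢ 0#
    noZeroDivisors    : ∀ {a b} → a ≢ 0# → b ≢ 0# → a * b ≢ 0#

module SliceRank (D : DecidableIntegralDomain) where

  open DecidableIntegralDomain D renaming (Carrier to R)

  commutativeRing : CommutativeRing 0ℓ 0ℓ
  commutativeRing = record { isCommutativeRing = isCommutativeRing }

  open CommutativeRing commutativeRing
    using (+-identityˡ; +-identityʳ; +-comm; *-comm; *-assoc; zeroˡ; zeroʳ; *-identityˡ; -‿inverseˡ; distribˡ;
           *-commutativeSemigroup; semiring; ring)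
  open import Algebra.Properties.Semiring.Sum semiring
    using (sum; sum-syntax; sum-cong-≗; sum-remove; ∑-distrib-+; ∑-comm; sum-replicate-zero; *-distribˡ-sum)
  open import Algebra.Properties.Ring ring using (-‿distribˡ-*)
  open import Algebra.Properties.CommutativeSemigroup *-commutativeSemigroup using (x∙yz≈y∙xz)

  ∑-cong : ∀ {m} {f g : Fin m → R} → (∀ b → f b ≡ g b) → ∑[ b < m ] f b ≡ ∑[ b < m ] g b
  ∑-cong {m} = sum-cong-≗ {m}

  ∑-zero : ∀ {m} (f : Fin m → R) → (∀ b → f b ≡ 0#) → ∑[ b < m ] f b ≡ 0#
  ∑-zero {m} f z = trans (∑-cong z) (sum-replicate-zero m)

  ∑-single : ∀ {m} (f : Fin m → R) s → (∀ b → b ≢ s → f b ≡ 0#) → ∑[ b < m ] f b ≡ f s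
  ∑-single {suc m} f s z = begin
    sum f                            ≡⟨ sum-remove {i = s} f ⟩
    f s + sum (f ∘ punchIn s)        ≡⟨ cong (f s +_) (∑-zero _ (λ t → z _ (Fin.punchInᵢ≢i s t))) ⟩
    f s + 0#                         ≡⟨ +-identityʳ (f s) ⟩
    f s                              ∎
    where open ≡-Reasoning

  ⟨_,_⟩ : ∀ {m} → (Fin m → R) → (Fin m → R) → R
  ⟨ v , f ⟩ = ∑[ b < _ ] (v b * f b)

  ⟨,⟩-cong : ∀ {m} (v : Fin m → R) {f g : Fin m → R} → (∀ b → f b ≡ g b) → ⟨ v , f ⟩ ≡ ⟨ v , g ⟩
  ⟨,⟩-cong v eq = ∑-cong (λ b → cong (v b *_) (eq b))

  ⟨,⟩-∑ : ∀ {m r} (v : Fin m → R) (F : Fin m → Fin r → R) →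
          ⟨ v , (λ b → ∑[ j < r ] F b j) ⟩ ≡ ∑[ j < r ] ⟨ v , (λ b → F b j) ⟩
  ⟨,⟩-∑ {m} {r} v F = trans (∑-cong {m} (λ b → *-distribˡ-sum {r} (v b) (F b))) (∑-comm {m} {r} _)

  ⟨,⟩-factorˡ : ∀ {m} (v f : Fin m → R) a → ⟨ v , (λ b → a * f b) ⟩ ≡ a * ⟨ v , f ⟩
  ⟨,⟩-factorˡ {m} v f a = trans (∑-cong (λ b → x∙yz≈y∙xz (v b) a (f b))) (sym (*-distribˡ-sum {m} a _))

  ⟨,⟩-factorʳ : ∀ {m} (v f : Fin m → R) a → ⟨ v , (λ b → f b * a) ⟩ ≡ ⟨ v , f ⟩ * a
  ⟨,⟩-factorʳ v f a = begin
    ⟨ v , (λ b → f b * a) ⟩ ≡⟨ ⟨,⟩-cong v (λ b → *-comm (f b) a) ⟩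
    ⟨ v , (λ b → a * f b) ⟩ ≡⟨ ⟨,⟩-factorˡ v f a ⟩
    a * ⟨ v , f ⟩           ≡⟨ *-comm a _ ⟩
    ⟨ v , f ⟩ * a           ∎
    where open ≡-Reasoning

  ⟨,⟩-+ : ∀ {m} (v f g : Fin m → R) → ⟨ v , (λ b → f b + g b) ⟩ ≡ ⟨ v , f ⟩ + ⟨ v , g ⟩
  ⟨,⟩-+ {m} v f g = trans (∑-cong {m} (λ b → distribˡ (v b) (f b) (g b))) (∑-distrib-+ {m} _ _)

  ⟨,⟩-neg : ∀ {m} (v f : Fin m → R) → ⟨ v , (λ b → - f b) ⟩ ≡ - ⟨ v , f ⟩
  ⟨,⟩-neg v f = begin
    ⟨ v , (λ b → - f b) ⟩      ≡⟨ ⟨,⟩-cong v (λ b → neg-as-scaling (f b)) ⟩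
    ⟨ v , (λ b → - 1# * f b) ⟩ ≡⟨ ⟨,⟩-factorˡ v f (- 1#) ⟩
    - 1# * ⟨ v , f ⟩           ≡⟨ neg-as-scaling _ ⟨
    - ⟨ v , f ⟩                ∎
    where
    open ≡-Reasoning
    neg-as-scaling : ∀ x → - x ≡ - 1# * x
    neg-as-scaling x = trans (cong -_ (sym (*-identityˡ x))) (-‿distribˡ-* 1# x)

  -- An annihilator of the functions f l : Fin m → R
  -- (l < r) is a vector v with ⟨ v , f l ⟩ = 0 for all l that is nonzero on
  -- an injectively embedded Fin size with m ≤ size + r: each linear condition
  -- costs at most one point of support.
  record Annihilator {m r : ℕ} (f : Fin r → Fin m → R) : Set where
    field
      size            : ℕ
      v               : Fin m → R
      support         : Fin size → Fin m
      support-inj     : Injective _≡_ _≡_ support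
      nonzero         : ∀ t → v (support t) ≢ 0#
      annihilates     : ∀ l → ⟨ v , f l ⟩ ≡ 0#
      large           : m ≤ size ℕ.+ r

  annihilator-skip : ∀ {m r} (f : Fin (suc r) → Fin m → R) → (∀ b → f zero b ≡ 0#) →
                     Annihilator (f ∘ suc) → Annihilator f
  annihilator-skip f f₀≡0 K = record
    { size = size ; v = v ; support = support ; support-inj = support-inj ; nonzero = nonzero
    ; annihilates = λ { zero    → ∑-zero _ (λ b → trans (cong (v b *_) (f₀≡0 b)) (zeroʳ (v b)))
                      ; (suc l) → annihilates l }
    ; large = ℕ.≤-trans large (ℕ.+-monoʳ-≤ size (ℕ.n≤1+n _)) }
    where open Annihilator K

  -- Elimination with a pivot s where f₀ = f zero does not vanish: every other
  -- condition χ is replaced by f₀ s · χ - χ s · f₀ on the remaining points.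
  eliminate : ∀ {m r} (f : Fin (suc r) → Fin (suc m) → R) (s : Fin (suc m)) → Fin r → Fin m → R
  eliminate f s l t = f zero s * f (suc l) (punchIn s t) + - (f (suc l) s * f zero (punchIn s t))

  annihilator-pivot : ∀ {m r} (f : Fin (suc r) → Fin (suc m) → R) s → f zero s ≢ 0# →
                      Annihilator (eliminate f s) → Annihilator f
  annihilator-pivot {m} {r} f s α≢0 K = record
    { size = size
    ; v = v
    ; support = punchIn s ∘ support
    ; support-inj = support-inj ∘ Fin.punchIn-injective s _ _
    ; nonzero = λ t → subst (_≢ 0#) (sym (Vector.insertAt-punchIn w′ s (- σ) (support t)))
                                    (noZeroDivisors α≢0 (nonzero t))
    ; annihilates = λ { zero → annihilates-pivot ; (suc l) → annihilates-rest l }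
    ; large = ℕ.≤-trans (s≤s large) (ℕ.≤-reflexive (sym (ℕ.+-suc size r))) }
    where
    open Annihilator K renaming (v to w)
    open ≡-Reasoning
    α : R
    α = f zero s
    σ : R
    σ = ⟨ w , f zero ∘ punchIn s ⟩
    w′ : Fin m → R
    w′ t = α * w t
    v : Fin (suc m) → R
    v = Vector.insertAt w′ s (- σ)

    split : ∀ χ → ⟨ v , χ ⟩ ≡ - σ * χ s + α * ⟨ w , χ ∘ punchIn s ⟩
    split χ = begin
      ⟨ v , χ ⟩                                            ≡⟨ sum-remove {i = s} (λ b → v b * χ b) ⟩
      v s * χ s + ⟨ v ∘ punchIn s , χ ∘ punchIn s ⟩        ≡⟨ cong₂ _+_ (cong (_* χ s) (Vector.insertAt-lookup w′ s (- σ)))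
                                                                        (∑-cong {m} (λ t → cong (_* χ (punchIn s t))
                                                                           (Vector.insertAt-punchIn w′ s (- σ) t))) ⟩
      - σ * χ s + ∑[ t < m ] ((α * w t) * χ (punchIn s t)) ≡⟨ cong (- σ * χ s +_) (⟨,⟩-factorˡ-assoc (χ ∘ punchIn s)) ⟩
      - σ * χ s + α * ⟨ w , χ ∘ punchIn s ⟩                ∎
      where
      ⟨,⟩-factorˡ-assoc : ∀ ψ → ∑[ t < m ] ((α * w t) * ψ t) ≡ α * ⟨ w , ψ ⟩
      ⟨,⟩-factorˡ-assoc ψ = trans (∑-cong {m} (λ t → *-assoc α (w t) (ψ t))) (sym (*-distribˡ-sum {m} α _))

    annihilates-pivot : ⟨ v , f zero ⟩ ≡ 0#
    annihilates-pivot = begin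
      ⟨ v , f zero ⟩       ≡⟨ split (f zero) ⟩
      - σ * α + α * σ      ≡⟨ cong₂ _+_ (sym (-‿distribˡ-* σ α)) (*-comm α σ) ⟩
      - (σ * α) + σ * α    ≡⟨ -‿inverseˡ (σ * α) ⟩
      0#                   ∎

    annihilates-rest : ∀ l → ⟨ v , f (suc l) ⟩ ≡ 0#
    annihilates-rest l = begin
      ⟨ v , χ ⟩                                         ≡⟨ split χ ⟩
      - σ * χ s + α * ⟨ w , χ ∘ punchIn s ⟩             ≡⟨ +-comm _ _ ⟩
      α * ⟨ w , χ ∘ punchIn s ⟩ + - σ * χ s             ≡⟨ cong (α * ⟨ w , χ ∘ punchIn s ⟩ +_)
                                                             (trans (sym (-‿distribˡ-* σ (χ s))) (cong -_ (*-comm σ (χ s)))) ⟩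
      α * ⟨ w , χ ∘ punchIn s ⟩ + - (χ s * σ)           ≡⟨ cong₂ (λ x y → x + - y) (⟨,⟩-factorˡ w _ α)
                                                                                    (⟨,⟩-factorˡ w _ (χ s)) ⟨
      ⟨ w , αχ ⟩ + - ⟨ w , χs·f₀ ⟩                      ≡⟨ cong (⟨ w , αχ ⟩ +_) (⟨,⟩-neg w χs·f₀) ⟨
      ⟨ w , αχ ⟩ + ⟨ w , (λ t → - χs·f₀ t) ⟩           ≡⟨ ⟨,⟩-+ w _ _ ⟨
      ⟨ w , eliminate f s l ⟩                           ≡⟨ annihilates l ⟩
      0#                                                          ∎
      where
      χ : Fin (suc m) → R
      χ = f (suc l)
      αχ χs·f₀ : Fin m → R
      αχ t = α * χ (punchIn s t)
      χs·f₀ t = χ s * f zero (punchIn s t)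

  annihilator : ∀ m r (f : Fin r → Fin m → R) → Annihilator f
  annihilator zero r f = record
    { size = 0 ; v = λ () ; support = λ () ; support-inj = λ {} ; nonzero = λ ()
    ; annihilates = λ _ → refl ; large = z≤n }
  annihilator (suc m) zero f = record
    { size = suc m ; v = λ _ → 1# ; support = id ; support-inj = id ; nonzero = λ _ → 1≢0
    ; annihilates = λ () ; large = ℕ.≤-reflexive (sym (ℕ.+-identityʳ (suc m))) }
  annihilator (suc m) (suc r) f with Fin.all? (λ b → f zero b ≟ 0#)
  ... | yes f₀≡0 = annihilator-skip f f₀≡0 (annihilator (suc m) r (f ∘ suc))
  ... | no  f₀≢0 = let s , α≢0 = Fin.¬∀⟶∃¬ _ _ (λ b → f zero b ≟ 0#) f₀≢0
                   in annihilator-pivot f s α≢0 (annihilator m r (eliminate f s))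

  -- Given functions φ i j : X → R for every slot i and
  -- j < r, a decomposition of T : X^(k+1) → R is a family g i j : X^k → R with
  --   T as = ∑_i ∑_j φ i j (as_i) · g i j (as with its i-th entry removed),
  -- witnessing that T has slice rank at most (k+1)·r.
  expand : ∀ {X : Set} {k r} → (Fin (suc k) → Fin r → X → R) → (Fin (suc k) → Fin r → Vec X k → R) →
           Vec X (suc k) → R
  expand {k = k} {r} φ g as = ∑[ i < suc k ] ∑[ j < r ] (φ i j (lookup as i) * g i j (removeAt as i))

  Decomposition : ∀ {X : Set} {k r} → (Fin (suc k) → Fin r → X → R) → (Vec X (suc k) → R) → Set
  Decomposition {X} {k} {r} φ T = Σ (Fin (suc k) → Fin r → Vec X k → R) λ g → ∀ as → T as ≡ expand φ g as

  restrict : ∀ {X Y : Set} {k r} (ι : Y → X) {φ : Fin (suc k) → Fin r → X → R} {T : Vec X (suc k) → R} →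
             Decomposition φ T → Decomposition (λ i j → φ i j ∘ ι) (T ∘ Vec.map ι)
  restrict {k = k} {r} ι {φ} (g , eq) = (λ i j → g i j ∘ Vec.map ι) , λ as →
    trans (eq (Vec.map ι as))
          (∑-cong {suc k} (λ i → ∑-cong {r} (λ j →
             cong₂ (λ x y → φ i j x * g i j y) (Vec.lookup-map i ι as) (removeAt-map ι as i))))

  module _ {X : Set} {k r} {φ : Fin (suc k) → Fin r → X → R} where

    decomposition-cong : ∀ {T T′ : Vec X (suc k) → R} → (∀ as → T as ≡ T′ as) → Decomposition φ T → Decomposition φ T′
    decomposition-cong T≡T′ (g , eq) = g , λ as → trans (sym (T≡T′ as)) (eq as)

    decomposition-zero : Decomposition φ (λ _ → 0#)
    decomposition-zero = (λ _ _ _ → 0#) , λ as → sym (∑-zero (λ i → ∑[ j < r ] (φ i j (lookup as i) * 0#))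
                                                       (λ i → ∑-zero (λ j → φ i j (lookup as i) * 0#) (λ j → zeroʳ _)))

    decomposition-+ : ∀ {T₁ T₂ : Vec X (suc k) → R} → Decomposition φ T₁ → Decomposition φ T₂ →
                      Decomposition φ (λ as → T₁ as + T₂ as)
    decomposition-+ {T₁} {T₂} (g₁ , eq₁) (g₂ , eq₂) = g , λ as → begin
      T₁ as + T₂ as                     ≡⟨ cong₂ _+_ (eq₁ as) (eq₂ as) ⟩
      expand φ g₁ as + expand φ g₂ as   ≡⟨ ∑-distrib-+ {suc k} (λ i → ∑[ j < r ] term g₁ as i j)
                                                                (λ i → ∑[ j < r ] term g₂ as i j) ⟨
      ∑[ i < suc k ] (∑[ j < r ] term g₁ as i j + ∑[ j < r ] term g₂ as i j)
                                        ≡⟨ ∑-cong {suc k} (λ i → ∑-distrib-+ {r} (term g₁ as i) (term g₂ as i)) ⟨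
      ∑[ i < suc k ] ∑[ j < r ] (term g₁ as i j + term g₂ as i j)
                                        ≡⟨ ∑-cong {suc k} (λ i → ∑-cong {r} (λ j →
                                             distribˡ (φ i j (lookup as i)) (g₁ i j (removeAt as i)) (g₂ i j (removeAt as i)))) ⟨
      expand φ g as                     ∎
      where
      open ≡-Reasoning
      g : Fin (suc k) → Fin r → Vec X k → R
      g i j cs = g₁ i j cs + g₂ i j cs
      term : (Fin (suc k) → Fin r → Vec X k → R) → Vec X (suc k) → Fin (suc k) → Fin r → R
      term h as i j = φ i j (lookup as i) * h i j (removeAt as i)

    decomposition-single : ∀ i j (G : Vec X k → R) → Decomposition φ (λ as → φ i j (lookup as i) * G (removeAt as i))
    decomposition-single i j G = g , λ as → sym (single-term as)
      where
      open ≡-Reasoning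
      g : Fin (suc k) → Fin r → Vec X k → R
      g i′ j′ cs = if does (i′ Fin.≟ i) ∧ does (j′ Fin.≟ j) then G cs else 0#
      off-slot : ∀ {i′ j′ cs} → i′ ≢ i → g i′ j′ cs ≡ 0#
      off-slot {i′} {j′} {cs} i′≢i = cong (λ b → if b ∧ does (j′ Fin.≟ j) then G cs else 0#) (dec-false (i′ Fin.≟ i) i′≢i)
      off-index : ∀ {j′ cs} → j′ ≢ j → g i j′ cs ≡ 0#
      off-index {j′} {cs} j′≢j = cong₂ (λ b c → if b ∧ c then G cs else 0#) (dec-true (i Fin.≟ i) refl)
                                                                             (dec-false (j′ Fin.≟ j) j′≢j)
      on-slice : ∀ {cs} → g i j cs ≡ G cs
      on-slice {cs} = cong₂ (λ b c → if b ∧ c then G cs else 0#) (dec-true (i Fin.≟ i) refl) (dec-true (j Fin.≟ j) refl)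
      single-term : ∀ as → expand φ g as ≡ φ i j (lookup as i) * G (removeAt as i)
      single-term as = begin
        expand φ g as                      ≡⟨ ∑-single (λ i′ → ∑[ j′ < r ] term i′ j′) i (λ i′ i′≢i →
                                                ∑-zero (term i′) (λ j′ → trans (cong (_ *_) (off-slot {j′ = j′} i′≢i)) (zeroʳ _))) ⟩
        ∑[ j′ < r ] term i j′              ≡⟨ ∑-single (term i) j (λ j′ j′≢j →
                                                trans (cong (_ *_) (off-index j′≢j)) (zeroʳ _)) ⟩
        term i j                           ≡⟨ cong (φ i j (lookup as i) *_) on-slice ⟩
        φ i j (lookup as i) * G (removeAt as i) ∎
        where
        term : Fin (suc k) → Fin r → R
        term i′ j′ = φ i′ j′ (lookup as i′) * g i′ j′ (removeAt as i′)

  contract : ∀ {m k} → (Fin m → R) → (Vec (Fin m) (suc (suc k)) → R) → Vec (Fin m) (suc k) → R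
  contract v T bs = ⟨ v , (λ b → T (b ∷ bs)) ⟩

  contract-decomposition : ∀ {m k r} {φ : Fin (suc (suc k)) → Fin r → Fin m → R} {T} (v : Fin m → R) →
    (∀ j → ⟨ v , φ zero j ⟩ ≡ 0#) → Decomposition φ T → Decomposition (φ ∘ suc) (contract v T)
  contract-decomposition {m} {k} {r} {φ} {T} v ann (g , eq) = g′ , λ bs → begin
    ⟨ v , (λ b → T (b ∷ bs)) ⟩                           ≡⟨ ⟨,⟩-cong v (λ b → eq (b ∷ bs)) ⟩
    ⟨ v , (λ b → first b bs + rest b bs) ⟩               ≡⟨ ⟨,⟩-+ v _ _ ⟩
    ⟨ v , (λ b → first b bs) ⟩ + ⟨ v , (λ b → rest b bs) ⟩ ≡⟨ cong₂ _+_ (first-vanishes bs) (rest-contracts bs) ⟩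
    0# + expand (φ ∘ suc) g′ bs                          ≡⟨ +-identityˡ _ ⟩
    expand (φ ∘ suc) g′ bs                               ∎
    where
    open ≡-Reasoning
    g′ : Fin (suc k) → Fin r → Vec (Fin m) k → R
    g′ i j cs = ⟨ v , (λ b → g (suc i) j (b ∷ cs)) ⟩

    first : Fin m → Vec (Fin m) (suc k) → R
    first b bs = ∑[ j < r ] (φ zero j b * g zero j bs)

    rest : Fin m → Vec (Fin m) (suc k) → R
    rest b bs = ∑[ i < suc k ] ∑[ j < r ] (φ (suc i) j (lookup bs i) * g (suc i) j (removeAt (b ∷ bs) (suc i)))

    first-vanishes : ∀ bs → ⟨ v , (λ b → first b bs) ⟩ ≡ 0#
    first-vanishes bs = trans (⟨,⟩-∑ v (λ b j → φ zero j b * g zero j bs)) (∑-zero _ (λ j →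
      trans (⟨,⟩-factorʳ v (φ zero j) _) (trans (cong (_* g zero j bs) (ann j)) (zeroˡ _))))

    rest-contracts : ∀ bs → ⟨ v , (λ b → rest b bs) ⟩ ≡ expand (φ ∘ suc) g′ bs
    rest-contracts bs = trans (⟨,⟩-∑ v (λ b i → slot b i)) (∑-cong {suc k} (λ i →
      trans (⟨,⟩-∑ v (λ b j → term b i j)) (∑-cong {r} (λ j →
      trans (⟨,⟩-cong v (λ b → cong (λ cs → φ (suc i) j (lookup bs i) * g (suc i) j cs) (removeAt-suc b bs i)))
            (⟨,⟩-factorˡ v _ _)))))
      where
      term : Fin m → Fin (suc k) → Fin r → R
      term b i j = φ (suc i) j (lookup bs i) * g (suc i) j (removeAt (b ∷ bs) (suc i))
      slot : Fin m → Fin (suc k) → R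
      slot b i = ∑[ j < r ] term b i j

  record Diagonal {m k} (T : Vec (Fin m) k → R) : Set where
    field
      on-diagonal  : ∀ a → T (replicate k a) ≢ 0#
      off-diagonal : ∀ as → ¬ AllEqual as → T as ≡ 0#

  contract-diagonal : ∀ {m m′ k} {T : Vec (Fin m) (suc (suc k)) → R} (v : Fin m → R) (ι : Fin m′ → Fin m) →
    Injective _≡_ _≡_ ι → (∀ t → v (ι t) ≢ 0#) → Diagonal T → Diagonal (contract v T ∘ Vec.map ι)
  contract-diagonal {k = k} {T} v ι ι-inj v≢0 diag = record
    { on-diagonal = λ a → subst (_≢ 0#) (sym (trans (cong (contract v T) (Vec.map-replicate ι a (suc k)))
                                                     (contracts-to-entry (ι a))))
                                        (noZeroDivisors (v≢0 a) (on-diagonal (ι a)))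
    ; off-diagonal = λ bs ¬eq → ∑-zero _ (λ b →
        trans (cong (v b *_) (off-diagonal _ (λ eq → ¬eq (λ i j → ι-inj (mapped-equal bs eq i j))))) (zeroʳ (v b))) }
    where
    open Diagonal diag
    -- on a constant tuple only the matching summand of the contraction survives
    contracts-to-entry : ∀ a → contract v T (replicate (suc k) a) ≡ v a * T (replicate (suc (suc k)) a)
    contracts-to-entry a = ∑-single _ a (λ b b≢a →
      trans (cong (v b *_) (off-diagonal _ (λ eq → b≢a (eq zero (suc zero))))) (zeroʳ (v b)))
    mapped-equal : ∀ bs {b} → AllEqual (b ∷ Vec.map ι bs) → ∀ i j → ι (lookup bs i) ≡ ι (lookup bs j)
    mapped-equal bs eq i j = trans (sym (Vec.lookup-map i ι bs)) (trans (eq (suc i) (suc j)) (Vec.lookup-map j ι bs))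

  -- Each step contracts the first slot against an annihilator of its r
  -- functions, losing at most r points of the diagonal.
  slice-rank-bound : ∀ k {m r} (φ : Fin (suc (suc k)) → Fin r → Fin m → R) (T : Vec (Fin m) (suc (suc k)) → R) →
                     Decomposition φ T → Diagonal T → m ≤ suc (suc k) ℕ.* r
  slice-rank-bound (suc k) {m} {r} φ T dec diag = begin
    m                           ≤⟨ large ⟩
    size ℕ.+ r                  ≤⟨ ℕ.+-monoˡ-≤ r (slice-rank-bound k (λ i j → φ (suc i) j ∘ support)
                                                    (contract v T ∘ Vec.map support) reduced-dec reduced-diag) ⟩
    suc (suc k) ℕ.* r ℕ.+ r     ≡⟨ ℕ.+-comm _ r ⟩
    suc (suc (suc k)) ℕ.* r     ∎
    where
    open ℕ.≤-Reasoning
    open Annihilator (annihilator m r (φ zero))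
    reduced-dec : Decomposition (λ i j → φ (suc i) j ∘ support) (contract v T ∘ Vec.map support)
    reduced-dec = restrict support {φ = φ ∘ suc} (contract-decomposition {φ = φ} v annihilates dec)
    reduced-diag : Diagonal (contract v T ∘ Vec.map support)
    reduced-diag = contract-diagonal v support support-inj nonzero diag
  -- For order two, annihilate the slot-0 functions and the slot-1 slices at
  -- once: the contraction then vanishes identically, so the support is empty.
  slice-rank-bound zero {m} {r} φ T dec@(g , _) diag = begin
    m                   ≤⟨ large ⟩
    size ℕ.+ (r ℕ.+ r)  ≡⟨ cong (ℕ._+ (r ℕ.+ r)) support-empty ⟩
    r ℕ.+ r             ≡⟨ cong (r ℕ.+_) (ℕ.+-identityʳ r) ⟨
    2 ℕ.* r             ∎
    where
    open ℕ.≤-Reasoning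
    ψ : Fin r → Fin m → R
    ψ j b = g (suc zero) j (b ∷ [])
    open Annihilator (annihilator m (r ℕ.+ r) (φ zero Vector.++ ψ))
    annihilates-φ : ∀ j → ⟨ v , φ zero j ⟩ ≡ 0#
    annihilates-φ j = subst (λ h → ⟨ v , h ⟩ ≡ 0#) (cong [ φ zero , ψ ]′ (Fin.splitAt-↑ˡ r j r)) (annihilates (j ↑ˡ r))
    annihilates-ψ : ∀ j → ⟨ v , ψ j ⟩ ≡ 0#
    annihilates-ψ j = subst (λ h → ⟨ v , h ⟩ ≡ 0#) (cong [ φ zero , ψ ]′ (Fin.splitAt-↑ʳ r r j)) (annihilates (r ↑ʳ j))
    reduced : Vec (Fin size) 1 → R
    reduced = contract v T ∘ Vec.map support
    reduced-vanishes : ∀ c → reduced (c ∷ []) ≡ 0#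
    reduced-vanishes c =
      trans (proj₂ (restrict support {φ = φ ∘ suc} (contract-decomposition {φ = φ} v annihilates-φ dec)) (c ∷ []))
            (trans (+-identityʳ _) (∑-zero _ (λ j → trans (cong (φ (suc zero) j (support c) *_) (annihilates-ψ j))
                                                             (zeroʳ _))))
    support-empty : size ≡ 0
    support-empty = empty-fin (λ c → Diagonal.on-diagonal (contract-diagonal v support support-inj nonzero diag) c
                                                          (reduced-vanishes c))

module PrimeField (q : ℕ) where

  p : ℕ
  p = suc (suc q)

  F : Set
  F = Fin p

  [_] : ℕ → F
  [ m ] = m mod p

  infixl 6 _+_
  infixl 7 _*_
  infix  8 -_

  _+_ : Op₂ F
  _+_ = _+F_ p

  _*_ : Op₂ F
  a * b = [ toℕ a ℕ.* toℕ b ]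

  -_ : Op₁ F
  - a = [ suc q ℕ.* toℕ a ]

  0# : F
  0# = 0F p

  1# : F
  1# = 1F p

  toℕ-[] : ∀ m → toℕ [ m ] ≡ m % p
  toℕ-[] m = Fin.toℕ-fromℕ< (m%n<n m p)

  []-toℕ : ∀ a → [ toℕ a ] ≡ a
  []-toℕ a = Fin.toℕ-injective (trans (toℕ-[] (toℕ a)) (m<n⇒m%n≡m (Fin.toℕ<n a)))

  []-% : ∀ m → [ m % p ] ≡ [ m ]
  []-% m = Fin.toℕ-injective (trans (toℕ-[] (m % p)) (trans (m%n%n≡m%n m p) (sym (toℕ-[] m))))

  []-+ : ∀ m n → [ m ] + [ n ] ≡ [ m ℕ.+ n ]
  []-+ m n = Fin.toℕ-injective (begin
    toℕ [ toℕ [ m ] ℕ.+ toℕ [ n ] ] ≡⟨ toℕ-[] (toℕ [ m ] ℕ.+ toℕ [ n ]) ⟩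
    (toℕ [ m ] ℕ.+ toℕ [ n ]) % p  ≡⟨ cong₂ (λ x y → (x ℕ.+ y) % p) (toℕ-[] m) (toℕ-[] n) ⟩
    (m % p ℕ.+ n % p) % p          ≡⟨ %-distribˡ-+ m n p ⟨
    (m ℕ.+ n) % p                  ≡⟨ toℕ-[] (m ℕ.+ n) ⟨
    toℕ [ m ℕ.+ n ]                ∎)
    where open ≡-Reasoning

  []-* : ∀ m n → [ m ] * [ n ] ≡ [ m ℕ.* n ]
  []-* m n = Fin.toℕ-injective (begin
    toℕ [ toℕ [ m ] ℕ.* toℕ [ n ] ] ≡⟨ toℕ-[] (toℕ [ m ] ℕ.* toℕ [ n ]) ⟩
    (toℕ [ m ] ℕ.* toℕ [ n ]) % p  ≡⟨ cong₂ (λ x y → (x ℕ.* y) % p) (toℕ-[] m) (toℕ-[] n) ⟩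
    (m % p ℕ.* (n % p)) % p        ≡⟨ %-distribˡ-* m n p ⟨
    (m ℕ.* n) % p                  ≡⟨ toℕ-[] (m ℕ.* n) ⟨
    toℕ [ m ℕ.* n ]                ∎)
    where open ≡-Reasoning

  -- Laws of F follow from laws of ℕ: every element is the reduction of a number.
  lift₁ : (P Q : F → F) → (∀ m → P [ m ] ≡ Q [ m ]) → ∀ a → P a ≡ Q a
  lift₁ P Q eq a = subst (λ x → P x ≡ Q x) ([]-toℕ a) (eq (toℕ a))

  lift₃ : (P Q : F → F → F → F) → (∀ l m n → P [ l ] [ m ] [ n ] ≡ Q [ l ] [ m ] [ n ]) → ∀ a b c → P a b c ≡ Q a b c
  lift₃ P Q eq a b c = lift₁ (λ x → P x b c) (λ x → Q x b c) (λ l →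
                       lift₁ (λ y → P [ l ] y c) (λ y → Q [ l ] y c) (λ m →
                       lift₁ (P [ l ] [ m ]) (Q [ l ] [ m ]) (eq l m) c) b) a

  +-assoc : ∀ a b c → (a + b) + c ≡ a + (b + c)
  +-assoc = lift₃ (λ a b c → (a + b) + c) (λ a b c → a + (b + c)) λ l m n → begin
    ([ l ] + [ m ]) + [ n ] ≡⟨ trans (cong (_+ [ n ]) ([]-+ l m)) ([]-+ (l ℕ.+ m) n) ⟩
    [ l ℕ.+ m ℕ.+ n ]       ≡⟨ cong [_] (ℕ.+-assoc l m n) ⟩
    [ l ℕ.+ (m ℕ.+ n) ]     ≡⟨ trans (cong ([ l ] +_) ([]-+ m n)) ([]-+ l (m ℕ.+ n)) ⟨
    [ l ] + ([ m ] + [ n ]) ∎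
    where open ≡-Reasoning

  *-assoc : ∀ a b c → (a * b) * c ≡ a * (b * c)
  *-assoc = lift₃ (λ a b c → (a * b) * c) (λ a b c → a * (b * c)) λ l m n → begin
    ([ l ] * [ m ]) * [ n ] ≡⟨ trans (cong (_* [ n ]) ([]-* l m)) ([]-* (l ℕ.* m) n) ⟩
    [ l ℕ.* m ℕ.* n ]       ≡⟨ cong [_] (ℕ.*-assoc l m n) ⟩
    [ l ℕ.* (m ℕ.* n) ]     ≡⟨ trans (cong ([ l ] *_) ([]-* m n)) ([]-* l (m ℕ.* n)) ⟨
    [ l ] * ([ m ] * [ n ]) ∎
    where open ≡-Reasoning

  distribˡ : ∀ a b c → a * (b + c) ≡ a * b + a * c
  distribˡ = lift₃ (λ a b c → a * (b + c)) (λ a b c → a * b + a * c) λ l m n → begin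
    [ l ] * ([ m ] + [ n ])     ≡⟨ trans (cong ([ l ] *_) ([]-+ m n)) ([]-* l (m ℕ.+ n)) ⟩
    [ l ℕ.* (m ℕ.+ n) ]         ≡⟨ cong [_] (ℕ.*-distribˡ-+ l m n) ⟩
    [ l ℕ.* m ℕ.+ l ℕ.* n ]     ≡⟨ trans (cong₂ _+_ ([]-* l m) ([]-* l n)) ([]-+ (l ℕ.* m) (l ℕ.* n)) ⟨
    [ l ] * [ m ] + [ l ] * [ n ] ∎
    where open ≡-Reasoning

  +-comm : ∀ a b → a + b ≡ b + a
  +-comm a b = cong [_] (ℕ.+-comm (toℕ a) (toℕ b))

  *-comm : ∀ a b → a * b ≡ b * a
  *-comm a b = cong [_] (ℕ.*-comm (toℕ a) (toℕ b))

  +-identityˡ : ∀ a → 0# + a ≡ a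
  +-identityˡ = []-toℕ

  *-identityˡ : ∀ a → 1# * a ≡ a
  *-identityˡ a = trans (cong [_] (ℕ.+-identityʳ (toℕ a))) ([]-toℕ a)

  -- a + - a reduces p · a, which is 0 modulo p
  -‿inverseʳ : ∀ a → a + - a ≡ 0#
  -‿inverseʳ a = begin
    a + - a               ≡⟨ cong (_+ - a) ([]-toℕ a) ⟨
    [ toℕ a ] + - a       ≡⟨ []-+ (toℕ a) _ ⟩
    [ p ℕ.* toℕ a ]       ≡⟨ []-% (p ℕ.* toℕ a) ⟨
    [ p ℕ.* toℕ a % p ]   ≡⟨ cong [_] (trans (cong (_% p) (ℕ.*-comm p (toℕ a))) (m*n%n≡0 (toℕ a) p)) ⟩
    0#                    ∎
    where open ≡-Reasoning

  isCommutativeRing : IsCommutativeRing _≡_ _+_ _*_ -_ 0# 1#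
  isCommutativeRing = record
    { isRing = record
      { +-isAbelianGroup = record
        { isGroup = record
          { isMonoid = record
            { isSemigroup = record
              { isMagma = record { isEquivalence = isEquivalence ; ∙-cong = cong₂ _+_ }
              ; assoc = +-assoc }
            ; identity = +-identityˡ , (λ a → trans (+-comm a 0#) (+-identityˡ a)) }
          ; inverse = (λ a → trans (+-comm (- a) a) (-‿inverseʳ a)) , -‿inverseʳ
          ; ⁻¹-cong = cong -_ }
        ; comm = +-comm }
      ; *-cong = cong₂ _*_
      ; *-assoc = *-assoc
      ; *-identity = *-identityˡ , (λ a → trans (*-comm a 1#) (*-identityˡ a))
      ; distrib = distribˡ , (λ a b c → trans (*-comm (b + c) a)
                                          (trans (distribˡ a b c) (cong₂ _+_ (*-comm a b) (*-comm a c)))) }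
    ; *-comm = *-comm }

  divisible⇒0 : ∀ a → p ∣ toℕ a → a ≡ 0#
  divisible⇒0 a p∣a = Fin.toℕ-injective (trans (sym (m<n⇒m%n≡m (Fin.toℕ<n a))) (n∣m⇒m%n≡0 _ p p∣a))

  noZeroDivisors : Prime p → ∀ {a b} → a ≢ 0# → b ≢ 0# → a * b ≢ 0#
  noZeroDivisors p-prime {a} {b} a≢0 b≢0 ab≡0
    with euclidsLemma (toℕ a) (toℕ b) p-prime
           (m%n≡0⇒n∣m (toℕ a ℕ.* toℕ b) p (trans (sym (toℕ-[] (toℕ a ℕ.* toℕ b))) (cong toℕ ab≡0)))
  ... | inj₁ p∣a = a≢0 (divisible⇒0 a p∣a)
  ... | inj₂ p∣b = b≢0 (divisible⇒0 b p∣b)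

  domain : Prime p → DecidableIntegralDomain
  domain p-prime = record
    { isCommutativeRing = isCommutativeRing
    ; _≟_ = Fin._≟_
    ; 1≢0 = λ ()
    ; noZeroDivisors = noZeroDivisors p-prime }

module BooleanCube (q : ℕ) (p-prime : Prime (suc (suc q))) (n : ℕ) where

  open PrimeField q using (p; F; [_]; _+_; _*_; 0#; 1#; []-+; []-*; []-toℕ; toℕ-[]; []-%; domain)
  open SliceRank (domain p-prime)
    using (commutativeRing; ∑-cong; Decomposition; decomposition-cong; decomposition-zero;
           decomposition-+; decomposition-single; restrict; Diagonal; slice-rank-bound)
  open CommutativeRing commutativeRing
    using (+-identityˡ; +-identityʳ; +-assoc; *-identityˡ; *-identityʳ; zeroˡ; zeroʳ; distribˡ; distribʳ;
           *-commutativeSemigroup; semiring)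
  open import Algebra.Properties.Semiring.Sum semiring using (sum-syntax)
  open import Algebra.Definitions.RawSemiring (Semiring.rawSemiring semiring) using (_^_)
  open import Algebra.Properties.CommutativeSemigroup *-commutativeSemigroup
    using (x∙yz≈y∙xz) renaming (interchange to *-interchange)

  X : Set
  X = Vec Bool n

  bit-∧ : ∀ x y → bit p (x ∧ y) ≡ bit p x * bit p y
  bit-∧ true  y = sym (*-identityˡ (bit p y))
  bit-∧ false y = sym (zeroˡ (bit p y))

  monomial : ∀ {m} → Mono p m → (Fin m → F) → F
  monomial []       x = 1#
  monomial (e ∷ es) x = x zero ^ toℕ e * monomial es (x ∘ suc)

  ∑ₗ : ∀ {A : Set} → List A → (A → F) → F
  ∑ₗ []       f = 0#
  ∑ₗ (x ∷ xs) f = f x + ∑ₗ xs f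

  ∑ₗ-++ : ∀ {A : Set} (xs ys : List A) (f : A → F) → ∑ₗ (xs ++ ys) f ≡ ∑ₗ xs f + ∑ₗ ys f
  ∑ₗ-++ []       ys f = sym (+-identityˡ (∑ₗ ys f))
  ∑ₗ-++ (x ∷ xs) ys f = trans (cong (f x +_) (∑ₗ-++ xs ys f)) (sym (+-assoc (f x) _ _))

  ∑ₗ-cong : ∀ {A : Set} (xs : List A) {f g : A → F} → (∀ x → f x ≡ g x) → ∑ₗ xs f ≡ ∑ₗ xs g
  ∑ₗ-cong []       eq = refl
  ∑ₗ-cong (x ∷ xs) eq = cong₂ _+_ (eq x) (∑ₗ-cong xs eq)

  ∑ₗ-map : ∀ {A B : Set} (g : A → B) (xs : List A) (f : B → F) → ∑ₗ (List.map g xs) f ≡ ∑ₗ xs (f ∘ g)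
  ∑ₗ-map g []       f = refl
  ∑ₗ-map g (x ∷ xs) f = cong (f (g x) +_) (∑ₗ-map g xs f)

  ∑ₗ-*ˡ : ∀ {A : Set} (c : F) (xs : List A) (f : A → F) → c * ∑ₗ xs f ≡ ∑ₗ xs (λ x → c * f x)
  ∑ₗ-*ˡ c []       f = zeroʳ c
  ∑ₗ-*ˡ c (x ∷ xs) f = trans (distribˡ c (f x) _) (cong (c * f x +_) (∑ₗ-*ˡ c xs f))

  -- Multilinear monomials on the cube.  A subset S of the coordinates picks
  -- the monomial ∏_{t ∈ S} a_t, i.e. the indicator that a covers S.
  covers : ∀ {m} → Subset m → Vec Bool m → Bool
  covers []       []       = true
  covers (s ∷ ss) (a ∷ as) = (not s ∨ a) ∧ covers ss as

  covers-⊥ : ∀ {m} (a : Vec Bool m) → covers ⊥ a ≡ true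
  covers-⊥ []       = refl
  covers-⊥ (a ∷ as) = covers-⊥ as

  covers-⁅⁆ : ∀ {m} (t : Fin m) (a : Vec Bool m) → covers ⁅ t ⁆ a ≡ lookup a t
  covers-⁅⁆ zero    (a ∷ as) = trans (cong (a ∧_) (covers-⊥ as)) (∧-identityʳ a)
  covers-⁅⁆ (suc t) (a ∷ as) = covers-⁅⁆ t as

  covers-∪ : ∀ {m} (s s′ : Subset m) (a : Vec Bool m) → covers (s ∪ s′) a ≡ covers s a ∧ covers s′ a
  covers-∪ []       []         []       = refl
  covers-∪ (s ∷ ss) (s′ ∷ ss′) (a ∷ as) = begin
    (not (s ∨ s′) ∨ a) ∧ covers (ss ∪ ss′) as                     ≡⟨ cong₂ _∧_ (factor s s′ a) (covers-∪ ss ss′ as) ⟩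
    ((not s ∨ a) ∧ (not s′ ∨ a)) ∧ (covers ss as ∧ covers ss′ as) ≡⟨ ∧-interchange (not s ∨ a) (not s′ ∨ a) _ _ ⟩
    ((not s ∨ a) ∧ covers ss as) ∧ ((not s′ ∨ a) ∧ covers ss′ as) ∎
    where
    open ≡-Reasoning
    open import Algebra.Properties.CommutativeSemigroup (CommutativeMonoid.commutativeSemigroup Bool.∧-commutativeMonoid)
      using () renaming (interchange to ∧-interchange)
    factor : ∀ s s′ a → not (s ∨ s′) ∨ a ≡ (not s ∨ a) ∧ (not s′ ∨ a)
    factor false s′    a     = refl
    factor true  s′    true  = sym (Bool.∨-zeroʳ (not s′))
    factor true  s′    false = refl

  ∣∪∣≤ : ∀ {m} (s s′ : Subset m) → ∣ s ∪ s′ ∣ ≤ ∣ s ∣ ℕ.+ ∣ s′ ∣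
  ∣∪∣≤ []           []           = z≤n
  ∣∪∣≤ (false ∷ ss) (false ∷ ss′) = ∣∪∣≤ ss ss′
  ∣∪∣≤ (false ∷ ss) (true  ∷ ss′) = ℕ.≤-trans (s≤s (∣∪∣≤ ss ss′)) (ℕ.≤-reflexive (sym (ℕ.+-suc _ _)))
  ∣∪∣≤ (true  ∷ ss) (false ∷ ss′) = s≤s (∣∪∣≤ ss ss′)
  ∣∪∣≤ (true  ∷ ss) (true  ∷ ss′) = s≤s (ℕ.≤-trans (∣∪∣≤ ss ss′) (ℕ.+-monoʳ-≤ ∣ ss ∣ (ℕ.n≤1+n _)))

  -- Selector monomials on k-tuples of points: one subset per slot, selecting
  -- the product of the monomials of the slots; its weight is its degree.
  Selector : ℕ → Set
  Selector k = Vec (Subset n) k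

  selected : ∀ {k} → Selector k → Vec X k → F
  selected []       []       = 1#
  selected (s ∷ ss) (a ∷ as) = bit p (covers s a) * selected ss as

  weight : ∀ {k} → Selector k → ℕ
  weight []       = 0
  weight (s ∷ ss) = ∣ s ∣ ℕ.+ weight ss

  record Term (k : ℕ) : Set where
    constructor _⊙_
    field
      coeff    : F
      selector : Selector k

  value : ∀ {k} → Term k → Vec X k → F
  value (c ⊙ s) as = c * selected s as

  SelPoly : ∀ k → ℕ → (Vec X k → F) → Set
  SelPoly k δ h = Σ (List (Term k)) λ ts →
    All (λ t → weight (Term.selector t) ≤ δ) ts × (∀ as → h as ≡ ∑ₗ ts (λ t → value t as))

  infixl 7 _·_
  _·_ : ∀ {k} → Term k → Term k → Term k
  (c ⊙ s) · (c′ ⊙ s′) = (c * c′) ⊙ Vec.zipWith _∪_ s s′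

  selected-∪ : ∀ {k} (s s′ : Selector k) as → selected (Vec.zipWith _∪_ s s′) as ≡ selected s as * selected s′ as
  selected-∪ []       []         []       = sym (*-identityˡ 1#)
  selected-∪ (s ∷ ss) (s′ ∷ ss′) (a ∷ as) = begin
    bit p (covers (s ∪ s′) a) * selected (Vec.zipWith _∪_ ss ss′) as
      ≡⟨ cong₂ _*_ (trans (cong (bit p) (covers-∪ s s′ a)) (bit-∧ (covers s a) (covers s′ a))) (selected-∪ ss ss′ as) ⟩
    (bit p (covers s a) * bit p (covers s′ a)) * (selected ss as * selected ss′ as)
      ≡⟨ *-interchange (bit p (covers s a)) (bit p (covers s′ a)) (selected ss as) (selected ss′ as) ⟩
    (bit p (covers s a) * selected ss as) * (bit p (covers s′ a) * selected ss′ as) ∎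
    where open ≡-Reasoning

  weight-∪ : ∀ {k} (s s′ : Selector k) → weight (Vec.zipWith _∪_ s s′) ≤ weight s ℕ.+ weight s′
  weight-∪ []       []         = z≤n
  weight-∪ (s ∷ ss) (s′ ∷ ss′) = ℕ.≤-trans (ℕ.+-mono-≤ (∣∪∣≤ s s′) (weight-∪ ss ss′))
                                           (ℕ.≤-reflexive (ℕ-interchange ∣ s ∣ ∣ s′ ∣ (weight ss) (weight ss′)))
    where open import Algebra.Properties.CommutativeSemigroup ℕ.+-commutativeSemigroup using ()
                                                               renaming (interchange to ℕ-interchange)

  value-· : ∀ {k} (t t′ : Term k) (as : Vec X k) → value (t · t′) as ≡ value t as * value t′ as
  value-· (c ⊙ s) (c′ ⊙ s′) as = trans (cong ((c * c′) *_) (selected-∪ s s′ as)) (*-interchange c c′ _ _)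

  products : ∀ {k} → List (Term k) → List (Term k) → List (Term k)
  products []       ts′ = []
  products (t ∷ ts) ts′ = List.map (t ·_) ts′ ++ products ts ts′

  ∑ₗ-products : ∀ {k} (ts ts′ : List (Term k)) (as : Vec X k) →
                ∑ₗ (products ts ts′) (λ t → value t as) ≡ ∑ₗ ts (λ t → value t as) * ∑ₗ ts′ (λ t → value t as)
  ∑ₗ-products []       ts′ as = sym (zeroˡ (∑ₗ ts′ (λ t → value t as)))
  ∑ₗ-products {k} (t ∷ ts) ts′ as = begin
    ∑ₗ (List.map (t ·_) ts′ ++ products ts ts′) V       ≡⟨ ∑ₗ-++ (List.map (t ·_) ts′) _ V ⟩
    ∑ₗ (List.map (t ·_) ts′) V + ∑ₗ (products ts ts′) V ≡⟨ cong₂ _+_ (∑ₗ-map (t ·_) ts′ V) (∑ₗ-products ts ts′ as) ⟩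
    ∑ₗ ts′ (λ t′ → V (t · t′)) + ∑ₗ ts V * ∑ₗ ts′ V     ≡⟨ cong (_+ ∑ₗ ts V * ∑ₗ ts′ V)
                                                             (trans (∑ₗ-cong ts′ (λ t′ → value-· t t′ as)) (sym (∑ₗ-*ˡ (V t) ts′ V))) ⟩
    V t * ∑ₗ ts′ V + ∑ₗ ts V * ∑ₗ ts′ V                 ≡⟨ distribʳ _ (V t) _ ⟨
    (V t + ∑ₗ ts V) * ∑ₗ ts′ V                          ∎
    where
    open ≡-Reasoning
    V : Term k → F
    V t = value t as

  inSlot : ∀ {k} → Fin k → Subset n → Selector k
  inSlot {k} i s = replicate k ⊥ Vec.[ i ]≔ s

  selected-⊥ : ∀ {k} (as : Vec X k) → selected (replicate k ⊥) as ≡ 1#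
  selected-⊥ []       = refl
  selected-⊥ (a ∷ as) = trans (cong₂ _*_ (cong (bit p) (covers-⊥ a)) (selected-⊥ as)) (*-identityˡ 1#)

  weight-⊥ : ∀ k → weight (replicate k ⊥) ≡ 0
  weight-⊥ zero    = refl
  weight-⊥ (suc k) = cong₂ ℕ._+_ (∣⊥∣≡0 n) (weight-⊥ k)

  selected-inSlot : ∀ {k} (i : Fin k) s (as : Vec X k) → selected (inSlot i s) as ≡ bit p (covers s (lookup as i))
  selected-inSlot zero    s (a ∷ as) = trans (cong (bit p (covers s a) *_) (selected-⊥ as)) (*-identityʳ _)
  selected-inSlot (suc i) s (a ∷ as) = trans (cong₂ _*_ (cong (bit p) (covers-⊥ a)) (selected-inSlot i s as))
                                             (*-identityˡ (bit p (covers s (lookup as i))))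

  weight-inSlot : ∀ {k} (i : Fin k) s → weight (inSlot i s) ≡ ∣ s ∣
  weight-inSlot {suc k} zero    s = trans (cong (∣ s ∣ ℕ.+_) (weight-⊥ k)) (ℕ.+-identityʳ _)
  weight-inSlot {suc k} (suc i) s = trans (cong (ℕ._+ weight (inSlot i s)) (∣⊥∣≡0 n)) (weight-inSlot i s)

  module _ {k : ℕ} where

    selPoly-cong : ∀ {δ} {h h′ : Vec X k → F} → (∀ as → h as ≡ h′ as) → SelPoly k δ h → SelPoly k δ h′
    selPoly-cong h≡h′ (ts , ws , eq) = ts , ws , λ as → trans (sym (h≡h′ as)) (eq as)

    selPoly-mono : ∀ {δ δ′} {h : Vec X k → F} → δ ≤ δ′ → SelPoly k δ h → SelPoly k δ′ h
    selPoly-mono δ≤δ′ (ts , ws , eq) = ts , All.map (λ w → ℕ.≤-trans w δ≤δ′) ws , eq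

    selPoly-zero : ∀ {δ} → SelPoly k δ (λ _ → 0#)
    selPoly-zero = [] , [] , λ _ → refl

    selPoly-+ : ∀ {δ} {h₁ h₂ : Vec X k → F} → SelPoly k δ h₁ → SelPoly k δ h₂ → SelPoly k δ (λ as → h₁ as + h₂ as)
    selPoly-+ (ts₁ , ws₁ , eq₁) (ts₂ , ws₂ , eq₂) =
      ts₁ ++ ts₂ , All.++⁺ ws₁ ws₂ , λ as → trans (cong₂ _+_ (eq₁ as) (eq₂ as)) (sym (∑ₗ-++ ts₁ ts₂ (λ t → value t as)))

    selPoly-* : ∀ {δ₁ δ₂} {h₁ h₂ : Vec X k → F} → SelPoly k δ₁ h₁ → SelPoly k δ₂ h₂ →
                SelPoly k (δ₁ ℕ.+ δ₂) (λ as → h₁ as * h₂ as)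
    selPoly-* {δ₁} {δ₂} (ts₁ , ws₁ , eq₁) (ts₂ , ws₂ , eq₂) =
      products ts₁ ts₂ , weights ws₁ , λ as → trans (cong₂ _*_ (eq₁ as) (eq₂ as)) (sym (∑ₗ-products ts₁ ts₂ as))
      where
      weights : ∀ {ts} → All (λ t → weight (Term.selector t) ≤ δ₁) ts →
                All (λ t → weight (Term.selector t) ≤ δ₁ ℕ.+ δ₂) (products ts ts₂)
      weights []                   = []
      weights {t ∷ _} (w₁ ∷ rest) = All.++⁺ (All.map⁺ (All.map (λ {t′} w₂ →
        ℕ.≤-trans (weight-∪ (Term.selector t) (Term.selector t′)) (ℕ.+-mono-≤ w₁ w₂)) ws₂)) (weights rest)

    selPoly-const : ∀ c → SelPoly k 0 (λ _ → c)
    selPoly-const c = (c ⊙ replicate k ⊥) ∷ [] , ℕ.≤-reflexive (weight-⊥ k) ∷ [] , λ as →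
      sym (trans (+-identityʳ _) (trans (cong (c *_) (selected-⊥ as)) (*-identityʳ c)))

    selPoly-scale : ∀ {δ} {h : Vec X k → F} c → SelPoly k δ h → SelPoly k δ (λ as → c * h as)
    selPoly-scale c = selPoly-* (selPoly-const c)

    selPoly-coordinate : ∀ i t → SelPoly k 1 (λ as → bit p (lookup (lookup as i) t))
    selPoly-coordinate i t = (1# ⊙ inSlot i ⁅ t ⁆) ∷ [] , ℕ.≤-reflexive (trans (weight-inSlot i ⁅ t ⁆) (∣⁅x⁆∣≡1 t)) ∷ [] ,
      λ as → sym (begin
        1# * selected (inSlot i ⁅ t ⁆) as + 0#     ≡⟨ +-identityʳ _ ⟩
        1# * selected (inSlot i ⁅ t ⁆) as          ≡⟨ *-identityˡ _ ⟩
        selected (inSlot i ⁅ t ⁆) as               ≡⟨ selected-inSlot i ⁅ t ⁆ as ⟩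
        bit p (covers ⁅ t ⁆ (lookup as i))         ≡⟨ cong (bit p) (covers-⁅⁆ t (lookup as i)) ⟩
        bit p (lookup (lookup as i) t)             ∎)
      where open ≡-Reasoning

    selPoly-∑ : ∀ {m δ} (h : Fin m → Vec X k → F) → (∀ i → SelPoly k δ (h i)) →
                SelPoly k δ (λ as → ∑[ i < m ] h i as)
    selPoly-∑ {zero}  h hs = selPoly-zero
    selPoly-∑ {suc m} h hs = selPoly-+ (hs zero) (selPoly-∑ (h ∘ suc) (hs ∘ suc))

    selPoly-∑ₗ : ∀ {A : Set} {δ} (xs : List A) (h : A → Vec X k → F) → (∀ x → SelPoly k δ (h x)) →
                 SelPoly k δ (λ as → ∑ₗ xs (λ x → h x as))
    selPoly-∑ₗ []       h hs = selPoly-zero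
    selPoly-∑ₗ (x ∷ xs) h hs = selPoly-+ (hs x) (selPoly-∑ₗ xs h hs)

    selPoly-^ : ∀ {h : Vec X k → F} → SelPoly k 1 h → ∀ e → SelPoly k e (λ as → h as ^ e)
    selPoly-^ h zero    = selPoly-const 1#
    selPoly-^ h (suc e) = selPoly-* h (selPoly-^ h e)

    selPoly-monomial : ∀ {m} (e : Mono p m) (y : Fin m → Vec X k → F) → (∀ t → SelPoly k 1 (y t)) →
                       SelPoly k (totalDeg p e) (λ as → monomial e (λ t → y t as))
    selPoly-monomial []       y ys = selPoly-const 1#
    selPoly-monomial (e ∷ es) y ys = selPoly-* (selPoly-^ (ys zero) (toℕ e)) (selPoly-monomial es (y ∘ suc) (ys ∘ suc))

    selPoly-polynomial : ∀ {d} (c : Poly p n) → HasDegLe p c d → (y : Fin n → Vec X k → F) → (∀ t → SelPoly k 1 (y t)) →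
                         SelPoly k d (λ as → ∑ₗ (allMonos p n) (λ e → c e * monomial e (λ t → y t as)))
    selPoly-polynomial {d} c deg≤d y ys = selPoly-∑ₗ (allMonos p n) _ term
      where
      term : ∀ e → SelPoly k d (λ as → c e * monomial e (λ t → y t as))
      term e with c e Fin.≟ 0#
      ... | yes c≡0 = selPoly-cong (λ as → sym (trans (cong (_* monomial e (λ t → y t as)) c≡0)
                                                        (zeroˡ (monomial e (λ t → y t as))))) selPoly-zero
      ... | no  c≢0 = selPoly-scale (c e) (selPoly-mono (deg≤d e c≢0) (selPoly-monomial e y ys))

  exponents : ∀ {m} → Subset m → Mono p m
  exponents = Vec.map (λ b → if b then suc zero else zero)

  totalDeg-exponents : ∀ {m} (s : Subset m) → totalDeg p (exponents s) ≡ ∣ s ∣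
  totalDeg-exponents []           = refl
  totalDeg-exponents (true  ∷ ss) = cong suc (totalDeg-exponents ss)
  totalDeg-exponents (false ∷ ss) = totalDeg-exponents ss

  monomial-exponents : ∀ {m} (s : Subset m) (a : Vec Bool m) →
                       monomial (exponents s) (lookup (embed p a)) ≡ bit p (covers s a)
  monomial-exponents []           []       = refl
  monomial-exponents (false ∷ ss) (a ∷ as) = trans (*-identityˡ _) (monomial-exponents ss as)
  monomial-exponents (true  ∷ ss) (a ∷ as) =
    trans (cong₂ _*_ (*-identityʳ (bit p a)) (monomial-exponents ss as)) (sym (bit-∧ a (covers ss as)))

  allMonos-complete : ∀ {m} (e : Mono p m) → e ∈ allMonos p m
  allMonos-complete []            = here refl
  allMonos-complete {suc m} (x ∷ e) =
    ∈-concat⁺′ (∈-map⁺ (x ∷_) (allMonos-complete e)) (∈-map⁺ (λ x′ → List.map (x′ ∷_) (allMonos p m)) (∈-allFin x))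

  selected-removeAt : ∀ {k} (s : Selector (suc k)) (as : Vec X (suc k)) i →
    selected s as ≡ bit p (covers (lookup s i) (lookup as i)) * selected (removeAt s i) (removeAt as i)
  selected-removeAt (s ∷ ss)      (a ∷ as)      zero    = refl
  selected-removeAt (s ∷ s′ ∷ ss) (a ∷ a′ ∷ as) (suc i) =
    trans (cong (bit p (covers s a) *_) (selected-removeAt (s′ ∷ ss) (a′ ∷ as) i))
          (x∙yz≈y∙xz (bit p (covers s a)) (bit p (covers (lookup (s′ ∷ ss) i) (lookup (a′ ∷ as) i)))
                     (selected (removeAt (s′ ∷ ss) i) (removeAt (a′ ∷ as) i)))

  pigeonhole : ∀ {k} m (s : Selector k) → weight s ℕ.< k ℕ.* suc m → Σ (Fin k) λ i → ∣ lookup s i ∣ ≤ m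
  pigeonhole m []       ()
  pigeonhole m (s ∷ ss) w< with ∣ s ∣ ℕ.≤? m
  ... | yes ∣s∣≤m = zero , ∣s∣≤m
  ... | no  ∣s∣≰m = let i , ∣sᵢ∣≤m = pigeonhole m ss (ℕ.+-cancelˡ-< (suc m) _ _ (ℕ.≤-<-trans
                                       (ℕ.+-monoˡ-≤ (weight ss) (ℕ.≰⇒> ∣s∣≰m)) w<))
                    in suc i , ∣sᵢ∣≤m

  below-next-multiple : ∀ d k .{{_ : ℕ.NonZero k}} → d ℕ.< k ℕ.* suc (d / k)
  below-next-multiple d k = begin-strict
    d                       ≡⟨ m≡m%n+[m/n]*n d k ⟩
    d % k ℕ.+ d / k ℕ.* k   <⟨ ℕ.+-monoˡ-< (d / k ℕ.* k) (m%n<n d k) ⟩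
    k ℕ.+ d / k ℕ.* k       ≡⟨ ℕ.*-comm (suc (d / k)) k ⟩
    k ℕ.* suc (d / k)       ∎
    where open ℕ.≤-Reasoning

  -- Selector polynomials of degree at most d on (k+1)-tuples decompose with
  -- the multilinear monomials of degree at most ⌊d/(k+1)⌋ in every slot: by
  -- pigeonhole, every selector monomial of weight ≤ d has a light slot.
  module Slicing (d k : ℕ) where

    Ms : List (Mono p n)
    Ms = M p (d / suc k) n

    φ : Fin (suc k) → Fin (List.length Ms) → X → F
    φ _ j a = monomial (List.lookup Ms j) (lookup (embed p a))

    decomposition-term : ∀ t → weight (Term.selector t) ≤ d → Decomposition φ (value t)
    decomposition-term (c ⊙ s) w≤d = decomposition-cong {φ = φ} split (decomposition-single {φ = φ} i j G)
      where
      light : Σ (Fin (suc k)) λ i → ∣ lookup s i ∣ ≤ d / suc k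
      light = pigeonhole (d / suc k) s (ℕ.≤-<-trans w≤d (below-next-multiple d (suc k)))
      i : Fin (suc k)
      i = proj₁ light
      in-Ms : exponents (lookup s i) ∈ Ms
      in-Ms = ∈-filter⁺ (λ e → totalDeg p e ℕ.≤? d / suc k) (allMonos-complete _)
                        (subst (_≤ d / suc k) (sym (totalDeg-exponents (lookup s i))) (proj₂ light))
      j : Fin (List.length Ms)
      j = Any.index in-Ms
      φ-slot : ∀ a → φ i j a ≡ bit p (covers (lookup s i) a)
      φ-slot a = trans (cong (λ e → monomial e (lookup (embed p a))) (sym (Any.lookup-index in-Ms)))
                       (monomial-exponents (lookup s i) a)
      G : Vec X k → F
      G cs = c * selected (removeAt s i) cs
      split : ∀ as → φ i j (lookup as i) * G (removeAt as i) ≡ value (c ⊙ s) as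
      split as = begin
        φ i j (lookup as i) * G (removeAt as i)       ≡⟨ cong (_* G (removeAt as i)) (φ-slot (lookup as i)) ⟩
        slot * (c * selected (removeAt s i) (removeAt as i)) ≡⟨ x∙yz≈y∙xz slot c _ ⟩
        c * (slot * selected (removeAt s i) (removeAt as i)) ≡⟨ cong (c *_) (selected-removeAt s as i) ⟨
        c * selected s as                             ∎
        where
        open ≡-Reasoning
        slot : F
        slot = bit p (covers (lookup s i) (lookup as i))

    decomposition-selPoly : ∀ {h} → SelPoly (suc k) d h → Decomposition φ h
    decomposition-selPoly (ts , ws , eq) = decomposition-cong {φ = φ} (λ as → sym (eq as)) (terms ts ws)
      where
      terms : ∀ ts → All (λ t → weight (Term.selector t) ≤ d) ts → Decomposition φ (λ as → ∑ₗ ts (λ t → value t as))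
      terms []       []       = decomposition-zero {φ = φ}
      terms (t ∷ ts) (w ∷ ws) = decomposition-+ {φ = φ} (decomposition-term t w) (terms ts ws)

  []-^ : ∀ m e → [ m ℕ.^ e ] ≡ [ m ] ^ e
  []-^ m zero    = refl
  []-^ m (suc e) = trans (sym ([]-* m (m ℕ.^ e))) (cong ([ m ] *_) ([]-^ m e))

  monomial-value : ∀ {m} (e : Mono p m) (x : Vec F m) → [ monoValℕ p e x ] ≡ monomial e (lookup x)
  monomial-value []       []       = refl
  monomial-value (e ∷ es) (x ∷ xs) =
    trans (sym ([]-* (toℕ x ℕ.^ toℕ e) (monoValℕ p es xs)))
          (cong₂ _*_ (trans ([]-^ (toℕ x) (toℕ e)) (cong (_^ toℕ e) ([]-toℕ x))) (monomial-value es xs))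

  eval-as-sum : ∀ (c : Poly p n) x → eval p c x ≡ ∑ₗ (allMonos p n) (λ e → c e * monomial e (lookup x))
  eval-as-sum c x = reduce-sum (allMonos p n)
    where
    value-ℕ : Mono p n → ℕ
    value-ℕ e = toℕ (c e) ℕ.* monoValℕ p e x
    reduce-sum : ∀ es → [ sumℕ (List.map value-ℕ es) ] ≡ ∑ₗ es (λ e → c e * monomial e (lookup x))
    reduce-sum []       = refl
    reduce-sum (e ∷ es) = trans (sym ([]-+ (value-ℕ e) _)) (cong₂ _+_
      (trans (sym ([]-* (toℕ (c e)) (monoValℕ p e x))) (cong₂ _*_ ([]-toℕ (c e)) (monomial-value e x)))
      (reduce-sum es))

  σ : ∀ {k} → Vec X k → Pt p n
  σ as = sumP p (Vec.map (embed p) as)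

  coordinate-σ : ∀ {k} (as : Vec X k) t → lookup (σ as) t ≡ ∑[ i < k ] bit p (lookup (lookup as i) t)
  coordinate-σ []       t = Vec.lookup-replicate t 0#
  coordinate-σ (a ∷ as) t = begin
    lookup (Vec.zipWith _+_ (embed p a) (σ as)) t     ≡⟨ Vec.lookup-zipWith _+_ t (embed p a) (σ as) ⟩
    lookup (embed p a) t + lookup (σ as) t            ≡⟨ cong₂ _+_ (Vec.lookup-map t (bit p) a) (coordinate-σ as t) ⟩
    bit p (lookup a t) + ∑[ i < _ ] bit p (lookup (lookup as i) t) ∎
    where open ≡-Reasoning

  selPoly-eval : ∀ {k d} (c : Poly p n) → HasDegLe p c d → SelPoly k d (λ as → eval p c (σ as))
  selPoly-eval c deg≤d =
    selPoly-cong (λ as → sym (eval-as-sum c (σ as)))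
      (selPoly-polynomial c deg≤d (λ t as → lookup (σ as) t) (λ t →
        selPoly-cong (λ as → sym (coordinate-σ as t))
          (selPoly-∑ (λ i as → bit p (lookup (lookup as i) t)) (λ i → selPoly-coordinate i t))))

  ∑-bits : ∀ {k} (S : Subset k) → ∑[ i < k ] bit p (lookup S i) ≡ [ ∣ S ∣ ]
  ∑-bits []          = refl
  ∑-bits (true  ∷ S) = trans (cong (1# +_) (∑-bits S)) ([]-+ 1 ∣ S ∣)
  ∑-bits (false ∷ S) = trans (cong (0# +_) (∑-bits S)) ([]-+ 0 ∣ S ∣)

  ∣S∣≡0⇒S≡⊥ : ∀ {k} (S : Subset k) → ∣ S ∣ ≡ 0 → S ≡ ⊥
  ∣S∣≡0⇒S≡⊥ []          _   = refl
  ∣S∣≡0⇒S≡⊥ (false ∷ S) ∣S∣≡0 = cong (false ∷_) (∣S∣≡0⇒S≡⊥ S ∣S∣≡0)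

  column-constant : ∀ (S : Subset p) → ∑[ i < p ] bit p (lookup S i) ≡ 0# → AllEqual S
  column-constant S ∑≡0 with ∣ S ∣ ℕ.<? p
  ... | yes ∣S∣<p = subst AllEqual (sym (∣S∣≡0⇒S≡⊥ S (trans (sym (m<n⇒m%n≡m ∣S∣<p)) count%p≡0))) (replicate-allEqual false)
    where
    count%p≡0 : ∣ S ∣ % p ≡ 0
    count%p≡0 = trans (sym (toℕ-[] ∣ S ∣)) (cong toℕ (trans (sym (∑-bits S)) ∑≡0))
  ... | no  ∣S∣≮p = subst AllEqual (sym (∣p∣≡n⇒p≡⊤ {p = S} (ℕ.≤-antisym (∣p∣≤n S) (ℕ.≮⇒≥ ∣S∣≮p)))) (replicate-allEqual true)

  constant-column : ∀ b → ∑[ i < p ] bit p b ≡ 0#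
  constant-column b = trans (∑-cong {p} (λ i → cong (bit p) (sym (Vec.lookup-replicate i b))))
                            (trans (∑-bits (replicate p b)) (count b))
    where
    count : ∀ b → [ ∣ replicate p b ∣ ] ≡ 0#
    count true  = trans (cong [_] (∣⊤∣≡n p)) (trans (sym ([]-% p)) (cong [_] (n%n≡0 p)))
    count false = cong [_] (∣⊥∣≡0 p)

  origin : Pt p n
  origin = replicate n 0#

  σ-replicate : ∀ a → σ (replicate p a) ≡ origin
  σ-replicate a = vec-ext λ t → begin
    lookup (σ (replicate p a)) t                       ≡⟨ coordinate-σ (replicate p a) t ⟩
    ∑[ i < p ] bit p (lookup (lookup (replicate p a) i) t) ≡⟨ ∑-cong {p} (λ i → cong (λ b → bit p (lookup b t))
                                                                                      (Vec.lookup-replicate i a)) ⟩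
    ∑[ i < p ] bit p (lookup a t)                      ≡⟨ constant-column (lookup a t) ⟩
    0#                                                 ≡⟨ Vec.lookup-replicate t 0# ⟨
    lookup origin t                                    ∎
    where open ≡-Reasoning

  σ≡origin⇒allEqual : ∀ (as : Vec X p) → σ as ≡ origin → AllEqual as
  σ≡origin⇒allEqual as σ≡0 i j = vec-ext λ t →
    trans (sym (Vec.lookup∘tabulate (column t) i))
          (trans (column-constant (Vec.tabulate (column t)) (column-sum t) i j) (Vec.lookup∘tabulate (column t) j))
    where
    column : Fin n → Fin p → Bool
    column t i = lookup (lookup as i) t
    column-sum : ∀ t → ∑[ i < p ] bit p (lookup (Vec.tabulate (column t)) i) ≡ 0#
    column-sum t = begin
      ∑[ i < p ] bit p (lookup (Vec.tabulate (column t)) i) ≡⟨ ∑-cong {p} (λ i → cong (bit p)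
                                                                                     (Vec.lookup∘tabulate (column t) i)) ⟩
      ∑[ i < p ] bit p (column t i)                       ≡⟨ coordinate-σ as t ⟨
      lookup (σ as) t                                     ≡⟨ cong (λ x → lookup x t) σ≡0 ⟩
      lookup origin t                                     ≡⟨ Vec.lookup-replicate t 0# ⟩
      0#                                                  ∎
      where open ≡-Reasoning

  indicator : Pt p n → F
  indicator x = if does (Vec.≡-dec Fin._≟_ x origin) then 1# else 0#

  indicator-origin : indicator origin ≡ 1#
  indicator-origin = cong (if_then 1# else 0#) (dec-true (Vec.≡-dec Fin._≟_ origin origin) refl)

  indicator-elsewhere : ∀ x → x ≢ origin → indicator x ≡ 0#
  indicator-elsewhere x x≢0 = cong (if_then 1# else 0#) (dec-false (Vec.≡-dec Fin._≟_ x origin) x≢0)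

  module _ (A : List X) (unique : Unique A) where

    point : Fin (List.length A) → X
    point = List.lookup A

    tensor : Poly p n → Vec (Fin (List.length A)) p → F
    tensor c is = eval p c (σ (Vec.map point is))

    -- If c interpolates the indicator of the origin on p·A, its tensor is
    -- diagonal with nonzero diagonal: p points sum to 0 iff they coincide.
    interpolant-diagonal : ∀ c → (∀ x → _∈pA_ p x A → eval p c x ≡ indicator x) → Diagonal (tensor c)
    interpolant-diagonal c agrees = record
      { on-diagonal = λ a → subst (_≢ 0#) (sym (begin
          tensor c (replicate p a)                         ≡⟨ on-indicator (replicate p a) ⟩
          indicator (σ (Vec.map point (replicate p a)))    ≡⟨ cong (indicator ∘ σ) (Vec.map-replicate point a p) ⟩
          indicator (σ (replicate p (point a)))            ≡⟨ cong indicator (σ-replicate (point a)) ⟩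
          indicator origin                                 ≡⟨ indicator-origin ⟩
          1#                                               ∎)) (λ ())
      ; off-diagonal = λ is ¬eq → trans (on-indicator is) (indicator-elsewhere (σ (Vec.map point is))
          (λ σ≡0 → ¬eq (λ i j → lookup-injective unique (begin
            point (lookup is i)               ≡⟨ Vec.lookup-map i point is ⟨
            lookup (Vec.map point is) i       ≡⟨ σ≡origin⇒allEqual (Vec.map point is) σ≡0 i j ⟩
            lookup (Vec.map point is) j       ≡⟨ Vec.lookup-map j point is ⟩
            point (lookup is j)               ∎)))) }
      where
      open ≡-Reasoning
      on-indicator : ∀ is → tensor c is ≡ indicator (σ (Vec.map point is))
      on-indicator is = agrees _
        (Vec.map point is , (λ i → subst (_∈ A) (sym (Vec.lookup-map i point is)) (∈-lookup (lookup is i))) , refl)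

    cube-bound : ∀ d → IntDegLe p (λ x → _∈pA_ p x A) d → List.length A ≤ p ℕ.* card-M p (d / p) n
    cube-bound d interpolate = slice-rank-bound q (λ i j → φ i j ∘ point) (tensor c) decomposition
                                                (interpolant-diagonal c agrees)
      where
      open Slicing d (suc q)
      c : Poly p n
      c = proj₁ (interpolate indicator)
      agrees : ∀ x → _∈pA_ p x A → eval p c x ≡ indicator x
      agrees = proj₂ (proj₂ (interpolate indicator))
      decomposition : Decomposition (λ i j → φ i j ∘ point) (tensor c)
      decomposition = restrict point {φ = φ} (decomposition-selPoly (selPoly-eval c (proj₁ (proj₂ (interpolate indicator)))))

open import Data.Nat using (_*_; _<_; NonZero)
open import Data.List using (length)

theorem4 : (p : ℕ) .{{_ : NonZero p}} → Prime p → (d n : ℕ) → 1 ≤ n →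
    (A : List (Vec Bool n)) → Unique A →
    p * card-M p (d / p) n < length A →
    ¬ IntDegLe p (λ x → _∈pA_ p x A) d
theorem4 zero          p-prime = contradiction p-prime ¬prime[0]
theorem4 (suc zero)    p-prime = contradiction p-prime ¬prime[1]
theorem4 (suc (suc q)) p-prime d n _ A unique |A|-large interpolate =
  ℕ.<⇒≱ |A|-large (BooleanCube.cube-bound q p-prime n A unique d interpolate)
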